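{- Let $\chi:[\omega]^2\rightarrow\omega$ be a $2$-bounded coloring and let $A\subseteq\omega$ be normal for $\chi$. If $X\subseteq A$ is polychromatic for $\chi$, $|X|\leq n$, and $a_0<\dots<a_n$ belong to $A\cap E(X)$, then $A\cap E(X)\subseteq^* A\cap\big(E(X\cup\{a_0\})\cup\dots\cup E(X\cup\{a_n\})\big)$.
   Context: A coloring $\chi:[\omega]^2\rightarrow\omega$ is $2$-bounded if each color is assigned to at most two pairs; write $\chi(a,b)$ for $\chi(\{a,b\})$. A set $Y$ is polychromatic for $\chi$ if distinct pairs from $Y$ receive distinct colors. A set $A\subseteq\omega$ is normal (for $\chi$) if whenever $a_0<a_1$ and $b_0<b_1$ are in $A$ with $\chi(a_0,a_1)=\chi(b_0,b_1)$, then $a_1=b_1$. For finite polychromatic $X$, $E(X)=\{a\in\omega: X\cup\{a\}\text{ is polychromatic}\}$. $C\subseteq^* D$ means $C\setminus D$ is finite. -}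

module Defs where

open import Data.Nat using (ℕ; _<_; _≤_)
open import Data.Product using (_×_; ∃-syntax)
open import Data.Sum using (_⊎_)
open import Data.List using (List)
open import Data.List.Membership.Propositional using (_∈_)
open import Relation.Binary.PropositionalEquality using (_≡_)

-- A coloring of [ω]² is a function χ : ℕ → ℕ → ℕ, where the color of the
-- pair {a,b} with a < b is χ a b; values χ a b with a ≥ b are irrelevant.
Coloring : Set
Coloring = ℕ → ℕ → ℕ

Subset : Set₁
Subset = ℕ → Set

TwoBounded : Coloring → Set
TwoBounded χ = ∀ a₀ a₁ b₀ b₁ c₀ c₁ → a₀ < a₁ → b₀ < b₁ → c₀ < c₁ →
  χ a₀ a₁ ≡ χ b₀ b₁ → χ b₀ b₁ ≡ χ c₀ c₁ →
  (a₀ ≡ b₀ × a₁ ≡ b₁) ⊎ (a₀ ≡ c₀ × a₁ ≡ c₁) ⊎ (b₀ ≡ c₀ × b₁ ≡ c₁)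

Polychromatic : Coloring → Subset → Set
Polychromatic χ Y = ∀ a₀ a₁ b₀ b₁ → Y a₀ → Y a₁ → Y b₀ → Y b₁ →
  a₀ < a₁ → b₀ < b₁ → χ a₀ a₁ ≡ χ b₀ b₁ → a₀ ≡ b₀ × a₁ ≡ b₁

Normal : Coloring → Subset → Set
Normal χ A = ∀ a₀ a₁ b₀ b₁ → A a₀ → A a₁ → A b₀ → A b₁ →
  a₀ < a₁ → b₀ < b₁ → χ a₀ a₁ ≡ χ b₀ b₁ → a₁ ≡ b₁

⟦_⟧ : List ℕ → Subset
⟦ X ⟧ x = x ∈ X

_∪｛_｝ : Subset → ℕ → Subset
(Y ∪｛ a ｝) x = Y x ⊎ x ≡ a

E : Coloring → Subset → Subset
E χ X a = Polychromatic χ (X ∪｛ a ｝)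

-- C ⊆* D : C ∖ D is finite, i.e. (for subsets of ω) bounded.
_⊆*_ : Subset → Subset → Set
C ⊆* D = ∃[ N ] (∀ x → N ≤ x → C x → D x)

module Submission where

-- Put N above every element of X and every aᵢ, and let x ≥ N
-- lie in A ∩ E(X).  Since A is normal and x is the largest point, a set
-- S ∪ {x} with S ⊆ A polychromatic below x is polychromatic as soon as the
-- colours χ(s,x), s ∈ S, are pairwise distinct (polychromatic-extension).
-- Call b blocked (at x) if some c ∈ X, c ≠ b, has χ(c,x) = χ(b,x).  For an
-- unblocked aᵢ the colours χ(s,x), s ∈ X ∪ {aᵢ}, are distinct, so x lies in
-- E(X ∪ {aᵢ}).  Some aᵢ is unblocked: otherwise each of the n+1 points aᵢ
-- has a witness in X, which has at most n elements, so by pigeonhole two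
-- points aᵢ ≠ aⱼ share a witness c, and the three distinct pairs {aᵢ,x},
-- {c,x}, {aⱼ,x} get one colour, contradicting 2-boundedness.

open import Defs
open import Data.Nat using (ℕ; suc; _<_; _≤_; _≟_; s≤s)
open import Data.Nat.Properties using (≤-trans; <-irrefl; <⇒≤; <⇒≢)
open import Data.Fin using (Fin)
import Data.Fin as F
open import Data.Fin.Properties using (pigeonhole; ¬∀⟶∃¬)
open import Data.Product using (_×_; ∃-syntax; _,_; proj₁; proj₂)
open import Data.Sum using (inj₁; inj₂)
open import Data.List using (List; length; lookup; tabulate; _++_)
open import Data.List.Extrema.Nat using (max; xs≤max)
open import Data.List.Relation.Unary.All using (All)
import Data.List.Relation.Unary.All as All
open import Data.List.Relation.Unary.Any using (Any; any?)
import Data.List.Relation.Unary.Any as Any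
open import Data.List.Relation.Unary.Any.Properties using (lookup-index)
open import Data.List.Relation.Unary.Unique.Propositional using (Unique)
open import Data.List.Membership.Propositional using (_∈_)
open import Data.List.Membership.Propositional.Properties
  using (∈-lookup; ∈-tabulate⁺; ∈-++⁺ˡ; ∈-++⁺ʳ)
open import Relation.Binary.PropositionalEquality using (_≡_; _≢_; refl; sym; trans; cong)
open import Relation.Nullary using (¬_; Dec)
open import Relation.Nullary.Decidable using (¬?; _×-dec_; decidable-stable)
open import Data.Empty using (⊥; ⊥-elim)

DistinctColoursTo : Coloring → Subset → ℕ → Set
DistinctColoursTo χ S x = ∀ {s t} → S s → S t → χ s x ≡ χ t x → s ≡ t

∪｛｝-all : ∀ {S b} {P : ℕ → Set} → (∀ {s} → S s → P s) → P b →
           ∀ {s} → (S ∪｛ b ｝) s → P s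
∪｛｝-all onS _  (inj₁ s)    = onS s
∪｛｝-all _   Pb (inj₂ refl) = Pb

below-top : ∀ {S x p} → (S ∪｛ x ｝) p → p < x → S p
below-top (inj₁ s)    _   = s
below-top (inj₂ refl) p<x = ⊥-elim (<-irrefl refl p<x)

-- Extension lemma for normal sets: if S ⊆ A is polychromatic and lies below
-- x ∈ A, then S ∪ {x} is polychromatic once the colours χ(s,x) are distinct.
-- (Normality rules out a colour shared by {p,q} ⊆ S and a pair {r,x}.)
polychromatic-extension :
  ∀ {χ A S x} → Normal χ A → (∀ {s} → S s → A s) → A x →
  (∀ {s} → S s → s < x) → Polychromatic χ S → DistinctColoursTo χ S x →
  Polychromatic χ (S ∪｛ x ｝)
polychromatic-extension {χ} {A} {S} {x} normal S⊆A Ax S<x polyS distinct =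
  extended
  where
  U⊆A : ∀ {u} → (S ∪｛ x ｝) u → A u
  U⊆A (inj₁ s)    = S⊆A s
  U⊆A (inj₂ refl) = Ax

  -- the top of a pair sharing its colour with a pair {r,x} must be x
  top-is-x : ∀ {p₀ p₁ r} → (S ∪｛ x ｝) p₀ → S p₁ → (S ∪｛ x ｝) r →
             p₀ < p₁ → r < x → χ p₀ p₁ ≡ χ r x → ⊥
  top-is-x u₀ s₁ v p₀<p₁ r<x eq =
    <-irrefl (normal _ _ _ _ (U⊆A u₀) (S⊆A s₁) (U⊆A v) Ax p₀<p₁ r<x eq) (S<x s₁)

  extended : Polychromatic χ (S ∪｛ x ｝)
  extended p₀ p₁ q₀ q₁ u₀ (inj₁ s₁) v₀ (inj₁ t₁) p₀<p₁ q₀<q₁ eq =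
    polyS p₀ p₁ q₀ q₁ (below-top {S} u₀ (≤-trans p₀<p₁ (<⇒≤ (S<x s₁))))
      s₁ (below-top {S} v₀ (≤-trans q₀<q₁ (<⇒≤ (S<x t₁)))) t₁ p₀<p₁ q₀<q₁ eq
  extended p₀ p₁ q₀ _ u₀ (inj₁ s₁) v₀ (inj₂ refl) p₀<p₁ q₀<x eq =
    ⊥-elim (top-is-x u₀ s₁ v₀ p₀<p₁ q₀<x eq)
  extended p₀ _ q₀ q₁ u₀ (inj₂ refl) v₀ (inj₁ t₁) p₀<x q₀<q₁ eq =
    ⊥-elim (top-is-x v₀ t₁ u₀ q₀<q₁ p₀<x (sym eq))
  extended p₀ _ q₀ _ u₀ (inj₂ refl) v₀ (inj₂ refl) p₀<x q₀<x eq =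
    distinct (below-top {S} u₀ p₀<x) (below-top {S} v₀ q₀<x) eq , refl

polychromatic-distinct : ∀ {χ S x} → Polychromatic χ (S ∪｛ x ｝) →
  (∀ {s} → S s → s < x) → DistinctColoursTo χ S x
polychromatic-distinct poly S<x s t eq =
  proj₁ (poly _ _ _ _ (inj₁ s) (inj₂ refl) (inj₁ t) (inj₂ refl) (S<x s) (S<x t) eq)

no-three-pairs-one-colour : ∀ {χ x b₀ c b₁} → TwoBounded χ →
  b₀ < x → c < x → b₁ < x → b₀ ≢ c → b₀ ≢ b₁ → c ≢ b₁ →
  χ b₀ x ≡ χ c x → χ c x ≡ χ b₁ x → ⊥
no-three-pairs-one-colour twoBounded b₀<x c<x b₁<x b₀≢c b₀≢b₁ c≢b₁ e₁ e₂
  with twoBounded _ _ _ _ _ _ b₀<x c<x b₁<x e₁ e₂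
... | inj₁ (b₀≡c , _)          = b₀≢c b₀≡c
... | inj₂ (inj₁ (b₀≡b₁ , _)) = b₀≢b₁ b₀≡b₁
... | inj₂ (inj₂ (c≡b₁ , _))  = c≢b₁ c≡b₁

-- b is blocked at x by X when some c ∈ X other than b gives the pair
-- {c,x} the colour of {b,x}; this is exactly what stops x ∈ E(X ∪ {b}).
BlockedBy : Coloring → List ℕ → ℕ → ℕ → Set
BlockedBy χ X x b = Any (λ c → c ≢ b × χ c x ≡ χ b x) X

-- Blocking is decidable, so "not all blocked" yields an unblocked point.
blocked? : ∀ χ X x b → Dec (BlockedBy χ X x b)
blocked? χ X x b = any? (λ c → ¬? (c ≟ b) ×-dec (χ c x ≟ χ b x)) X

-- Pigeonhole: more distinct points below x than X has elements cannot all
-- be blocked, since two of them would share a blocking c ∈ X.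
not-all-blocked : ∀ {χ m x} {X : List ℕ} → TwoBounded χ → length X < m →
  (a : Fin m → ℕ) → (∀ i j → i F.< j → a i ≢ a j) →
  (∀ i → a i < x) → (∀ {c} → c ∈ X → c < x) →
  ¬ (∀ i → BlockedBy χ X x (a i))
not-all-blocked {χ} {x = x} {X} twoBounded |X|<m a distinct a<x X<x blocked
  with pigeonhole |X|<m (λ i → Any.index (blocked i))
... | i , j , i<j , same-index =
  no-three-pairs-one-colour twoBounded (a<x i) (X<x (∈-lookup k)) (a<x j)
    (λ eq → proj₁ blockerᵢ (sym eq)) (distinct i j i<j) c≢aⱼ
    (sym (proj₂ blockerᵢ)) (trans (cong colourAt same-index) (proj₂ blockerⱼ))
  where
  k : Fin (length X)
  k = Any.index (blocked i)
  colourAt : Fin (length X) → ℕ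
  colourAt k′ = χ (lookup X k′) x
  blockerᵢ : lookup X k ≢ a i × χ (lookup X k) x ≡ χ (a i) x
  blockerᵢ = lookup-index (blocked i)
  blockerⱼ : lookup X (Any.index (blocked j)) ≢ a j ×
             colourAt (Any.index (blocked j)) ≡ χ (a j) x
  blockerⱼ = lookup-index (blocked j)
  c≢aⱼ : lookup X k ≢ a j
  c≢aⱼ eq = proj₁ blockerⱼ (trans (cong (lookup X) (sym same-index)) eq)

some-unblocked : ∀ {χ m x} {X : List ℕ} → TwoBounded χ → length X < m →
  (a : Fin m → ℕ) → (∀ i j → i F.< j → a i ≢ a j) →
  (∀ i → a i < x) → (∀ {c} → c ∈ X → c < x) →
  ∃[ i ] ¬ BlockedBy χ X x (a i)
some-unblocked {χ} {m} {x} {X} twoBounded |X|<m a distinct a<x X<x =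
  ¬∀⟶∃¬ m (λ i → BlockedBy χ X x (a i)) (λ i → blocked? χ X x (a i))
    (not-all-blocked twoBounded |X|<m a distinct a<x X<x)

unblocked-colour : ∀ {χ X x b c} → ¬ BlockedBy χ X x b →
  c ∈ X → χ c x ≡ χ b x → c ≡ b
unblocked-colour unblocked c∈X eq =
  decidable-stable (_ ≟ _) (λ c≢b → unblocked (Any.map (λ { refl → c≢b , eq }) c∈X))

unblocked-distinct : ∀ {χ X x b} → DistinctColoursTo χ ⟦ X ⟧ x →
  ¬ BlockedBy χ X x b → DistinctColoursTo χ (⟦ X ⟧ ∪｛ b ｝) x
unblocked-distinct distinctX _ (inj₁ s) (inj₁ t) eq = distinctX s t eq
unblocked-distinct {χ} {X} _ unblocked (inj₁ s) (inj₂ refl) eq =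
  unblocked-colour {χ} {X} unblocked s eq
unblocked-distinct {χ} {X} _ unblocked (inj₂ refl) (inj₁ t) eq =
  sym (unblocked-colour {χ} {X} unblocked t (sym eq))
unblocked-distinct _ _ (inj₂ refl) (inj₂ refl) _ = refl

strictBound : List ℕ → ℕ
strictBound xs = suc (max 0 xs)

below-strictBound : ∀ {xs c x} → strictBound xs ≤ x → c ∈ xs → c < x
below-strictBound {xs} N≤x c∈xs = ≤-trans (s≤s (All.lookup (xs≤max 0 xs) c∈xs)) N≤x

mainTheorem12 : (χ : Coloring) → TwoBounded χ →
    (A : Subset) → Normal χ A →
    (n : ℕ) (X : List ℕ) → Unique X → All A X → Polychromatic χ ⟦ X ⟧ →
    length X ≤ n →
    (a : Fin (suc n) → ℕ) → (∀ i j → i F.< j → a i < a j) →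
    (∀ i → A (a i) × E χ ⟦ X ⟧ (a i)) →
    (λ x → A x × E χ ⟦ X ⟧ x) ⊆*
    (λ x → A x × ∃[ i ] E χ (⟦ X ⟧ ∪｛ a i ｝) x)
mainTheorem12 χ twoBounded A normal n X _ X⊆A _ |X|≤n a increasing a∈A∩E =
  strictBound relevant , λ x N≤x (Ax , Ex) → Ax , extendable x N≤x Ax Ex
  where
  relevant : List ℕ
  relevant = X ++ tabulate a

  extendable : ∀ x → strictBound relevant ≤ x → A x → E χ ⟦ X ⟧ x →
               ∃[ i ] E χ (⟦ X ⟧ ∪｛ a i ｝) x
  extendable x N≤x Ax Ex =
    i , polychromatic-extension normal S⊆A Ax S<x (proj₂ (a∈A∩E i)) distinctS
    where
    X<x : ∀ {c} → c ∈ X → c < x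
    X<x c∈X = below-strictBound {relevant} N≤x (∈-++⁺ˡ c∈X)
    a<x : ∀ i → a i < x
    a<x i = below-strictBound {relevant} N≤x (∈-++⁺ʳ X (∈-tabulate⁺ {f = a} i))
    unblocked : ∃[ i ] ¬ BlockedBy χ X x (a i)
    unblocked = some-unblocked {χ} twoBounded (s≤s |X|≤n) a
                  (λ i j i<j → <⇒≢ (increasing i j i<j)) a<x X<x
    i : Fin (suc n)
    i = proj₁ unblocked
    S : Subset
    S = ⟦ X ⟧ ∪｛ a i ｝
    S⊆A : ∀ {s} → S s → A s
    S⊆A = ∪｛｝-all {⟦ X ⟧} (All.lookup X⊆A) (proj₁ (a∈A∩E i))
    S<x : ∀ {s} → S s → s < x
    S<x = ∪｛｝-all {⟦ X ⟧} X<x (a<x i)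
    distinctS : DistinctColoursTo χ S x
    distinctS = unblocked-distinct {χ} (polychromatic-distinct {S = ⟦ X ⟧} Ex X<x)
                  (proj₂ unblocked)
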